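{- Let $G$ be a graph and let $R\subseteq V(G)$ (with $|R|\ge 2$) be a minimal vertex cut of $G$ such that $G-R$ has $k$ components. Then $G$ has a Pendant $R$-CIST of size $k$.
   Context: Graphs are finite and connected, may have parallel edges but no loops. A minimal vertex cut is a set $S$ with $G-S$ disconnected such that no proper subset of $S$ has this property. For a tree $T$, $\mathrm{int}(T)$ is the set of vertices of degree at least 2 and $L(T)$ the set of leaves. An $R$-Steiner tree is a subtree $T$ with $R\subseteq V(T)$ and $L(T)\subseteq R$; it is pendant if $L(T)=R$. $T(u,v)$ is the unique $(u,v)$-path in $T$. An $R$-CIST of size $k$ is a set $\{T_1,\dots,T_k\}$ of $R$-Steiner trees such that for all distinct $u,v\in R$ and distinct $i,j$, $T_i(u,v)$ and $T_j(u,v)$ are edge-disjoint and internally vertex-disjoint; it is a Pendant $R$-CIST if every $T_i$ is a pendant $R$-Steiner tree. -}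

module Defs where

open import Data.Nat using (ℕ)
open import Data.Fin using (Fin; _≟_)
open import Data.Fin.Subset using (Subset; _⊂_) renaming (_∈_ to _∈ₛ_; _∉_ to _∉ₛ_; _⊆_ to _⊆ₛ_)
open import Data.Fin.Subset.Properties using (_∈?_)
open import Data.List using (List; []; _∷_; length; filter; allFin)
open import Data.List.Membership.Propositional using (_∈_; _∉_)
open import Data.List.Relation.Unary.All using (All)
open import Data.List.Relation.Unary.Unique.Propositional using (Unique)
open import Data.Product using (Σ; _×_; ∃; ∃₂; _,_)
open import Data.Sum using (_⊎_)
open import Relation.Nullary using (¬_; _×-dec_; _⊎-dec_)
open import Relation.Binary.PropositionalEquality using (_≡_; _≢_)

record Graph : Set where
  field
    nV nE   : ℕ
    src tgt : Fin nE → Fin nV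
    loopless : ∀ e → src e ≢ tgt e

module _ (G : Graph) where
  open Graph G

  Vertex : Set
  Vertex = Fin nV

  Edge : Set
  Edge = Fin nE

  Joins : Edge → Vertex → Vertex → Set
  Joins e u v = (src e ≡ u × tgt e ≡ v) ⊎ (src e ≡ v × tgt e ≡ u)

  data Walk : Vertex → Vertex → Set where
    nil  : ∀ v → Walk v v
    cons : ∀ {u v w} (e : Edge) → Joins e u v → Walk v w → Walk u w

  verts : ∀ {u w} → Walk u w → List Vertex
  verts (nil v) = v ∷ []
  verts (cons {u} e _ p) = u ∷ verts p

  edges : ∀ {u w} → Walk u w → List Edge
  edges (nil v) = []
  edges (cons e _ p) = e ∷ edges p

  IsPath : ∀ {u w} → Walk u w → Set
  IsPath p = Unique (verts p)

  Connected : Set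
  Connected = ∀ u v → Walk u v

  ConnectedAvoiding : Subset nV → Vertex → Vertex → Set
  ConnectedAvoiding S u v = Σ (Walk u v) (λ p → All (_∉ₛ S) (verts p))

  IsVertexCut : Subset nV → Set
  IsVertexCut S = ∃₂ λ u v → u ∉ₛ S × v ∉ₛ S × ¬ ConnectedAvoiding S u v

  IsMinimalVertexCut : Subset nV → Set
  IsMinimalVertexCut S = IsVertexCut S × (∀ S' → S' ⊂ S → ¬ IsVertexCut S')

  -- G - S has exactly k components: a surjective labelling of the
  -- vertices of G - S by Fin k whose fibres are exactly the components.
  HasComponents : Subset nV → ℕ → Set
  HasComponents S k =
    Σ ((v : Vertex) → v ∉ₛ S → Fin k) λ c →
      (∀ i → ∃ λ v → Σ (v ∉ₛ S) λ p → c v p ≡ i) ×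
      (∀ u v (p : u ∉ₛ S) (q : v ∉ₛ S) →
         (c u p ≡ c v q → ConnectedAvoiding S u v) ×
         (ConnectedAvoiding S u v → c u p ≡ c v q))

  record Subgraph : Set where
    field
      VT : Subset nV
      ET : Subset nE
      closed : ∀ e → e ∈ₛ ET → src e ∈ₛ VT × tgt e ∈ₛ VT

  open Subgraph

  WalkIn : (T : Subgraph) → ∀ {u w} → Walk u w → Set
  WalkIn T p = All (_∈ₛ ET T) (edges p)

  PathIn : (T : Subgraph) → ∀ {u w} → Walk u w → Set
  PathIn T p = WalkIn T p × IsPath p

  IsTree : Subgraph → Set
  IsTree T =
    (∀ u v → u ∈ₛ VT T → v ∈ₛ VT T → Σ (Walk u v) (WalkIn T)) ×
    (∀ u v (p q : Walk u v) → PathIn T p → PathIn T q → edges p ≡ edges q)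

  degree : Subgraph → Vertex → ℕ
  degree T v = length (filter (λ e → (e ∈? ET T) ×-dec ((src e ≟ v) ⊎-dec (tgt e ≟ v))) (allFin nE))

  IsLeaf : Subgraph → Vertex → Set
  IsLeaf T v = v ∈ₛ VT T × degree T v ≡ 1

  IsSteinerTree : Subset nV → Subgraph → Set
  IsSteinerTree R T = IsTree T × R ⊆ₛ VT T × (∀ v → IsLeaf T v → v ∈ₛ R)

  IsPendantSteinerTree : Subset nV → Subgraph → Set
  IsPendantSteinerTree R T = IsSteinerTree R T × (∀ v → v ∈ₛ R → IsLeaf T v)

  EdgeDisjoint : ∀ {u v} → Walk u v → Walk u v → Set
  EdgeDisjoint p q = ∀ e → e ∈ edges p → e ∉ edges q

  InternallyDisjoint : ∀ {u v} → Walk u v → Walk u v → Set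
  InternallyDisjoint {u} {v} p q = ∀ x → x ∈ verts p → x ∈ verts q → (x ≡ u ⊎ x ≡ v)

  -- R-CIST of size k (the unique path T_i(u,v) is quantified over as any path in T_i)
  IsCIST : Subset nV → (k : ℕ) → (Fin k → Subgraph) → Set
  IsCIST R k Ts =
    (∀ i → IsSteinerTree R (Ts i)) ×
    (∀ u v → u ∈ₛ R → v ∈ₛ R → u ≢ v → ∀ i j → i ≢ j →
       ∀ (p q : Walk u v) → PathIn (Ts i) p → PathIn (Ts j) q →
       EdgeDisjoint p q × InternallyDisjoint p q)

  IsPendantCIST : Subset nV → (k : ℕ) → (Fin k → Subgraph) → Set
  IsPendantCIST R k Ts = IsCIST R k Ts × (∀ i → IsPendantSteinerTree R (Ts i))

{-# OPTIONS --safe #-}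
module Submission where

-- Fix a component Cᵢ of G − R. By minimality of the cut every r ∈ R has a neighbour aᵢ(r) in Cᵢ,
-- for otherwise R − r would still separate Cᵢ from the other components. Take a spanning tree of Cᵢ,
-- repeatedly delete vertices of degree at most one that are not of the form aᵢ(r), and hang every
-- r ∈ R on its edge r aᵢ(r). In the resulting tree Tᵢ each r ∈ R has degree one, and every other
-- vertex has degree at least two: a vertex aᵢ(r) carries the edge to r and either an edge of the
-- pruned tree or, if that tree is a single vertex, the edges to two vertices of R (here |R| ≥ 2 is
-- used). So the leaves of Tᵢ are exactly R. Two trees Tᵢ, Tⱼ share no edge, since every edge of Tᵢ has
-- an end in Cᵢ, and they meet only in R, where each has a single edge; so a vertex of R occurs on a
-- path of Tᵢ only as an end, and paths between vertices of R in Tᵢ and Tⱼ are edge-disjoint and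
-- internally disjoint.

open import Defs
open import Data.Nat using (ℕ; _≥_)
open import Data.Fin using (Fin)
open import Data.Fin.Subset using (Subset; ∣_∣)
open import Data.Product using (Σ)

open import Data.Nat using (zero; suc; _≤_; _≤?_; s≤s; z≤n)
open import Data.Nat.Properties using (≰⇒>; n≮n)
open import Data.Fin using (zero; suc; _≟_)
open import Data.Fin.Properties using (suc-injective; any?)
open import Data.Fin.Subset using (Nonempty; ⁅_⁆; _∪_; _-_; _⊂_; _⊃_; inside; outside)
  renaming (_∈_ to _∈ₛ_; _∉_ to _∉ₛ_; _⊆_ to _⊆ₛ_; ⊥ to ∅)
open import Data.Fin.Subset.Properties
  using (_∈?_; x∈p∪q⁻; x∈p∪q⁺; p⊆p∪q; x∈⁅x⁆; x∈⁅y⁆⇒x≡y; ∉⊥; x∈p⇒p-x⊂p; x∈p∧x≢y⇒x∈p-y; p─q⊆p)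
open import Data.Fin.Subset.Induction using (Acc; acc; ⊂-wellFounded; ⊃-wellFounded)
open import Data.Vec.Base using ([]; _∷_; here; there)
open import Data.List.Base using (List; []; _∷_; _++_; [_]; length; filter; allFin)
open import Data.List.Membership.Propositional using (_∈_; _∉_)
open import Data.List.Membership.Propositional.Properties using (∈-filter⁺; ∈-filter⁻; ∈-allFin)
open import Data.List.Relation.Unary.Any using (here; there)
open import Data.List.Relation.Unary.All as All using (All; []; _∷_)
import Data.List.Relation.Unary.All.Properties as All
open import Data.List.Relation.Unary.AllPairs using ([]; _∷_)
open import Data.List.Relation.Unary.Unique.Propositional using (Unique)
open import Data.List.Relation.Unary.Unique.Propositional.Properties using (allFin⁺; filter⁺)
import Data.List.Relation.Unary.Unique.Propositional.Properties as Unique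
open import Data.Product using (∃; ∃₂; _×_; _,_; proj₁; proj₂)
import Data.Product as Product
open import Data.Sum using (_⊎_; inj₁; inj₂)
import Data.Sum as Sum
open import Function using (_∘_; id)
open import Relation.Nullary using (¬_; Dec; yes; no; does; contradiction; map′; _×-dec_; _⊎-dec_; ¬?)
open import Relation.Nullary.Decidable using (decidable-stable)
open import Relation.Unary using (Decidable)
open import Relation.Binary.PropositionalEquality using (_≡_; _≢_; refl; sym; trans; cong; subst)

subsetOf : ∀ {n} {P : Fin n → Set} → Decidable P → Subset n
subsetOf {zero}  P? = []
subsetOf {suc n} P? = does (P? zero) ∷ subsetOf (P? ∘ suc)

∈-subsetOf⁻ : ∀ {n} {P : Fin n → Set} (P? : Decidable P) {x} → x ∈ₛ subsetOf P? → P x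
∈-subsetOf⁻ P? {zero} x∈ with P? zero
... | yes px = px
∈-subsetOf⁻ P? {suc x} (there x∈) = ∈-subsetOf⁻ (P? ∘ suc) x∈

∈-subsetOf⁺ : ∀ {n} {P : Fin n → Set} (P? : Decidable P) {x} → P x → x ∈ₛ subsetOf P?
∈-subsetOf⁺ P? {zero} px with P? zero
... | yes _  = here
... | no ¬px = contradiction px ¬px
∈-subsetOf⁺ P? {suc x} px = there (∈-subsetOf⁺ (P? ∘ suc) px)

x∈p∪⁅y⁆⁻ : ∀ {n} {p : Subset n} {x y} → x ∈ₛ p ∪ ⁅ y ⁆ → x ∈ₛ p ⊎ x ≡ y
x∈p∪⁅y⁆⁻ {p = p} {y = y} = Sum.map₂ (x∈⁅y⁆⇒x≡y y) ∘ x∈p∪q⁻ p ⁅ y ⁆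

x∈p∪⁅x⁆ : ∀ {n} {p : Subset n} x → x ∈ₛ p ∪ ⁅ x ⁆
x∈p∪⁅x⁆ x = x∈p∪q⁺ (inj₂ (x∈⁅x⁆ x))

1≤∣p∣⇒Nonempty : ∀ {n} (p : Subset n) → 1 ≤ ∣ p ∣ → Nonempty p
1≤∣p∣⇒Nonempty (inside  ∷ p) _     = zero , here
1≤∣p∣⇒Nonempty (outside ∷ p) 1≤∣p∣ with 1≤∣p∣⇒Nonempty p 1≤∣p∣
... | x , x∈p = suc x , there x∈p

2≤∣p∣⇒∃-distinct : ∀ {n} (p : Subset n) → 2 ≤ ∣ p ∣ → ∃₂ λ x y → x ∈ₛ p × y ∈ₛ p × x ≢ y
2≤∣p∣⇒∃-distinct (inside  ∷ p) (s≤s 1≤∣p∣) with 1≤∣p∣⇒Nonempty p 1≤∣p∣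
... | y , y∈p = zero , suc y , here , there y∈p , λ ()
2≤∣p∣⇒∃-distinct (outside ∷ p) 2≤∣p∣ with 2≤∣p∣⇒∃-distinct p 2≤∣p∣
... | x , y , x∈p , y∈p , x≢y = suc x , suc y , there x∈p , there y∈p , x≢y ∘ suc-injective

module _ {A : Set} where

  length≤1⇒∈-unique : ∀ {xs : List A} {x y} → length xs ≤ 1 → x ∈ xs → y ∈ xs → x ≡ y
  length≤1⇒∈-unique {_ ∷ []}    _         (here refl) (here refl) = refl
  length≤1⇒∈-unique {_ ∷ _ ∷ _} (s≤s ()) _           _

  ∈-distinct⇒2≤length : ∀ {xs : List A} {x y} → x ∈ xs → y ∈ xs → x ≢ y → 2 ≤ length xs
  ∈-distinct⇒2≤length {_ ∷ []}    (here refl) (here refl) x≢y = contradiction refl x≢y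
  ∈-distinct⇒2≤length {_ ∷ _ ∷ _} _           _           _   = s≤s (s≤s z≤n)

  Unique∧2≤length⇒∃-distinct : ∀ {xs : List A} → Unique xs → 2 ≤ length xs →
                                ∃₂ λ x y → x ∈ xs × y ∈ xs × x ≢ y
  Unique∧2≤length⇒∃-distinct {x ∷ y ∷ _} ((x≢y ∷ _) ∷ _) _         = x , y , here refl , there (here refl) , x≢y
  Unique∧2≤length⇒∃-distinct {_ ∷ []}    _               (s≤s ())

  Unique∧∈-unique⇒length≡1 : ∀ {xs : List A} {x} → Unique xs → x ∈ xs → (∀ {y} → y ∈ xs → y ≡ x) →
                             length xs ≡ 1
  Unique∧∈-unique⇒length≡1 {_ ∷ []}    _               _ _  = refl
  Unique∧∈-unique⇒length≡1 {_ ∷ _ ∷ _} ((x≢y ∷ _) ∷ _) _ ≡x =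
    contradiction (trans (≡x (here refl)) (sym (≡x (there (here refl))))) x≢y

module GraphTheory (G : Graph) where
  open Graph G
  open Subgraph

  private variable
    u v w x y : Vertex G
    e f : Edge G
    T : Subgraph G

  Incident : Edge G → Vertex G → Set
  Incident e v = src e ≡ v ⊎ tgt e ≡ v

  Incident? : ∀ e v → Dec (Incident e v)
  Incident? e v = (src e ≟ v) ⊎-dec (tgt e ≟ v)

  Joins-sym : Joins G e u v → Joins G e v u
  Joins-sym = Sum.swap

  Joins-functional : Joins G e x v → Joins G e x w → v ≡ w
  Joins-functional (inj₁ (_ , t₁)) (inj₁ (_ , t₂)) = trans (sym t₁) t₂
  Joins-functional (inj₁ (s₁ , _)) (inj₂ (_ , t₂)) = contradiction (trans s₁ (sym t₂)) (loopless _)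
  Joins-functional (inj₂ (_ , t₁)) (inj₁ (s₂ , _)) = contradiction (trans s₂ (sym t₁)) (loopless _)
  Joins-functional (inj₂ (s₁ , _)) (inj₂ (s₂ , _)) = trans (sym s₁) s₂

  Joins⇒Incidentˡ : Joins G e u v → Incident e u
  Joins⇒Incidentˡ (inj₁ (s , _)) = inj₁ s
  Joins⇒Incidentˡ (inj₂ (_ , t)) = inj₂ t

  Joins⇒Incidentʳ : Joins G e u v → Incident e v
  Joins⇒Incidentʳ = Joins⇒Incidentˡ ∘ Joins-sym

  Incident⇒endpoint : Joins G e u v → Incident e x → x ≡ u ⊎ x ≡ v
  Incident⇒endpoint (inj₁ (s , _)) (inj₁ s′) = inj₁ (trans (sym s′) s)
  Incident⇒endpoint (inj₁ (_ , t)) (inj₂ t′) = inj₂ (trans (sym t′) t)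
  Incident⇒endpoint (inj₂ (s , _)) (inj₁ s′) = inj₂ (trans (sym s′) s)
  Incident⇒endpoint (inj₂ (_ , t)) (inj₂ t′) = inj₁ (trans (sym t′) t)

  Joins⇒endpoints∈ : ∀ {X : Subset nV} → Joins G e u v → u ∈ₛ X → v ∈ₛ X → src e ∈ₛ X × tgt e ∈ₛ X
  Joins⇒endpoints∈ {X = X} (inj₁ (s , t)) u∈X v∈X = subst (_∈ₛ X) (sym s) u∈X , subst (_∈ₛ X) (sym t) v∈X
  Joins⇒endpoints∈ {X = X} (inj₂ (s , t)) u∈X v∈X = subst (_∈ₛ X) (sym s) v∈X , subst (_∈ₛ X) (sym t) u∈X

  Incident⇒∈VT : (T : Subgraph G) → e ∈ₛ ET T → Incident e v → v ∈ₛ VT T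
  Incident⇒∈VT T e∈T (inj₁ refl) = proj₁ (closed T _ e∈T)
  Incident⇒∈VT T e∈T (inj₂ refl) = proj₂ (closed T _ e∈T)

  head∈verts : (p : Walk G u w) → u ∈ verts G p
  head∈verts (nil _)      = here refl
  head∈verts (cons _ _ _) = here refl

  last∈verts : (p : Walk G u w) → w ∈ verts G p
  last∈verts (nil _)      = here refl
  last∈verts (cons _ _ p) = there (last∈verts p)

  Incident⇒∈verts : (p : Walk G u w) → f ∈ edges G p → Incident f x → x ∈ verts G p
  Incident⇒∈verts (cons _ j p) (here refl) f-at-x with Incident⇒endpoint j f-at-x
  ... | inj₁ refl = here refl
  ... | inj₂ refl = there (head∈verts p)
  Incident⇒∈verts (cons _ _ p) (there f∈p) f-at-x = there (Incident⇒∈verts p f∈p f-at-x)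

  snoc : Walk G u v → Joins G e v w → Walk G u w
  snoc (nil _)       j = cons _ j (nil _)
  snoc (cons e′ j′ p) j = cons e′ j′ (snoc p j)

  verts-snoc : (p : Walk G u v) (j : Joins G e v w) → verts G (snoc p j) ≡ verts G p ++ [ w ]
  verts-snoc (nil _)      j = refl
  verts-snoc (cons _ _ p) j = cong (_ ∷_) (verts-snoc p j)

  edges-snoc : (p : Walk G u v) (j : Joins G e v w) → edges G (snoc p j) ≡ edges G p ++ [ e ]
  edges-snoc (nil _)      j = refl
  edges-snoc (cons _ _ p) j = cong (_ ∷_) (edges-snoc p j)

  closedPath⇒edges≡[] : (p : Walk G u u) → IsPath G p → edges G p ≡ []
  closedPath⇒edges≡[] (nil _)      _          = refl
  closedPath⇒edges≡[] (cons _ _ p) (u∉p ∷ _) = contradiction refl (All.lookup u∉p (last∈verts p))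

  WalkIn⇒verts∈VT : (T : Subgraph G) (p : Walk G u w) → WalkIn G T p → u ∈ₛ VT T → All (_∈ₛ VT T) (verts G p)
  WalkIn⇒verts∈VT T (nil _)      _             u∈T = u∈T ∷ []
  WalkIn⇒verts∈VT T (cons _ j p) (e∈T ∷ pInT) u∈T =
    u∈T ∷ WalkIn⇒verts∈VT T p pInT (Incident⇒∈VT T e∈T (Joins⇒Incidentʳ j))

  AtMostOneEdgeAt : Subgraph G → Vertex G → Set
  AtMostOneEdgeAt T x = ∀ {e f} → e ∈ₛ ET T → f ∈ₛ ET T → Incident e x → Incident f x → e ≡ f

  AtMostOneEdgeAt⇒endpoint : (p : Walk G u w) → PathIn G T p → AtMostOneEdgeAt T x → x ∈ verts G p →
                             x ≡ u ⊎ x ≡ w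
  AtMostOneEdgeAt⇒endpoint (nil _)      _ _ (here refl) = inj₁ refl
  AtMostOneEdgeAt⇒endpoint (cons _ _ _) _ _ (here refl) = inj₁ refl
  AtMostOneEdgeAt⇒endpoint {T = T} (cons _ j p) (e∈T ∷ pInT , u∉p ∷ pPath) one (there x∈p)
    with AtMostOneEdgeAt⇒endpoint {T = T} p (pInT , pPath) one x∈p
  ... | inj₂ x≡w  = inj₂ x≡w
  ... | inj₁ refl = inj₂ (stop e∈T j one p pInT u∉p)
    where
    stop : e ∈ₛ ET T → Joins G e u v → AtMostOneEdgeAt T v →
           (q : Walk G v w) → WalkIn G T q → All (u ≢_) (verts G q) → v ≡ w
    stop _   _ _   (nil _)        _          _         = refl
    stop e∈T j one (cons e′ j′ q) (e′∈T ∷ _) (_ ∷ u∉q)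
      with one e∈T e′∈T (Joins⇒Incidentʳ j) (Joins⇒Incidentˡ j′)
    ... | refl = contradiction (Joins-functional (Joins-sym j) j′) (All.lookup u∉q (head∈verts q))

  PathConnected : Subgraph G → Set
  PathConnected T = ∀ {u v} → u ∈ₛ VT T → v ∈ₛ VT T → Σ (Walk G u v) (PathIn G T)

  UniquePaths : Subgraph G → Set
  UniquePaths T = ∀ {u v} (p q : Walk G u v) → PathIn G T p → PathIn G T q → edges G p ≡ edges G q

  IsPathTree : Subgraph G → Set
  IsPathTree T = PathConnected T × UniquePaths T

  IsPathTree⇒IsTree : IsPathTree T → IsTree G T
  IsPathTree⇒IsTree (connected , unique) =
    (λ _ _ u∈T v∈T → Product.map₂ proj₁ (connected u∈T v∈T)) , λ _ _ → unique

  addLeaf : (T : Subgraph G) → Joins G e x y → y ∈ₛ VT T → Subgraph G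
  addLeaf {e = e} {x = x} T j y∈T = record
    { VT     = VT T ∪ ⁅ x ⁆
    ; ET     = ET T ∪ ⁅ e ⁆
    ; closed = closed′
    }
    where
    closed′ : ∀ f → f ∈ₛ ET T ∪ ⁅ e ⁆ → src f ∈ₛ VT T ∪ ⁅ x ⁆ × tgt f ∈ₛ VT T ∪ ⁅ x ⁆
    closed′ f f∈ with x∈p∪⁅y⁆⁻ f∈
    ... | inj₁ f∈T  = Product.map (p⊆p∪q _) (p⊆p∪q _) (closed T f f∈T)
    ... | inj₂ refl = Joins⇒endpoints∈ j (x∈p∪⁅x⁆ x) (p⊆p∪q _ y∈T)

  addLeaf-⊃ : ∀ T (j : Joins G e x y) (y∈T : y ∈ₛ VT T) → x ∉ₛ VT T → VT (addLeaf T j y∈T) ⊃ VT T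
  addLeaf-⊃ {x = x} _ _ _ x∉T = p⊆p∪q _ , x , x∈p∪⁅x⁆ x , x∉T

  private
    module AddLeaf {e x y} (T : Subgraph G) (j : Joins G e x y) (y∈T : y ∈ₛ VT T) (x∉T : x ∉ₛ VT T)
                   (tree : IsPathTree T) where
      T′ : Subgraph G
      T′ = addLeaf T j y∈T

      connected : PathConnected T
      connected = proj₁ tree

      unique : UniquePaths T
      unique = proj₂ tree

      edge-at-x : f ∈ₛ ET T′ → Incident f x → f ≡ e
      edge-at-x f∈T′ f-at-x with x∈p∪⁅y⁆⁻ f∈T′
      ... | inj₁ f∈T = contradiction (Incident⇒∈VT T f∈T f-at-x) x∉T
      ... | inj₂ f≡e = f≡e

      oneEdgeAt-x : AtMostOneEdgeAt T′ x
      oneEdgeAt-x e∈ f∈ e-at-x f-at-x = trans (edge-at-x e∈ e-at-x) (sym (edge-at-x f∈ f-at-x))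

      lower : (p : Walk G u v) → WalkIn G T′ p → x ∉ verts G p → WalkIn G T p
      lower p pIn x∉p = All.tabulate λ f∈p → old f∈p (x∈p∪⁅y⁆⁻ (All.lookup pIn f∈p))
        where
        old : f ∈ edges G p → f ∈ₛ ET T ⊎ f ≡ e → f ∈ₛ ET T
        old _   (inj₁ f∈T) = f∈T
        old f∈p (inj₂ refl) = contradiction (Incident⇒∈verts p f∈p (Joins⇒Incidentˡ j)) x∉p

      x≢verts : (p : Walk G u v) → WalkIn G T p → u ∈ₛ VT T → All (x ≢_) (verts G p)
      x≢verts p pIn u∈T = All.map (λ v∈T x≡v → x∉T (subst (_∈ₛ VT T) (sym x≡v) v∈T)) (WalkIn⇒verts∈VT T p pIn u∈T)

      avoiding-x : (p : Walk G u v) → PathIn G T′ p → u ≢ x → v ≢ x → PathIn G T p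
      avoiding-x p (pIn , pPath) u≢x v≢x = lower p pIn x∉p , pPath
        where
        x∉p : x ∉ verts G p
        x∉p x∈p = Sum.[ u≢x ∘ sym , v≢x ∘ sym ] (AtMostOneEdgeAt⇒endpoint {T = T′} p (pIn , pPath) oneEdgeAt-x x∈p)

      fromLeaf : (p : Walk G x v) → PathIn G T′ p → v ≢ x →
              Σ (Walk G y v) λ p′ → PathIn G T p′ × edges G p ≡ e ∷ edges G p′
      fromLeaf (nil _)       _                              v≢x = contradiction refl v≢x
      fromLeaf (cons f jf p) (f∈T′ ∷ pIn , x∉p ∷ pPath) _ with edge-at-x f∈T′ (Joins⇒Incidentˡ jf)
      ... | refl with Joins-functional jf j
      ...   | refl = p , (lower p pIn (λ x∈p → All.lookup x∉p x∈p refl) , pPath) , refl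

      toLeaf : (p : Walk G u x) → PathIn G T′ p → u ≢ x →
             Σ (Walk G u y) λ p′ → PathIn G T p′ × edges G p ≡ edges G p′ ++ [ e ] × verts G p ≡ verts G p′ ++ [ x ]
      toLeaf (nil _) _ u≢x = contradiction refl u≢x
      toLeaf (cons f jf (nil _)) (f∈T′ ∷ [] , _) _ with edge-at-x f∈T′ (Joins⇒Incidentʳ jf)
      ... | refl with Joins-functional (Joins-sym jf) j
      ...   | refl = nil _ , ([] , [] ∷ []) , refl , refl
      toLeaf {u} (cons f jf p@(cons _ _ q)) (f∈T′ ∷ pIn , u∉p ∷ pPath@(u′∉q ∷ _)) u≢x
        with toLeaf p (pIn , pPath) (All.lookup u′∉q (last∈verts q))
      ... | p′ , (p′In , p′Path) , edges≡ , verts≡ =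
        cons f jf p′ , (f∈T ∷ p′In , All.++⁻ˡ (verts G p′) (subst (All (u ≢_)) verts≡ u∉p) ∷ p′Path) ,
        cong (f ∷_) edges≡ , cong (u ∷_) verts≡
        where
        f∈T : f ∈ₛ ET T
        f∈T with x∈p∪⁅y⁆⁻ f∈T′
        ... | inj₁ f∈T  = f∈T
        ... | inj₂ refl with Incident⇒endpoint jf (Joins⇒Incidentˡ j)
        ...   | inj₁ x≡u = contradiction (sym x≡u) u≢x
        ...   | inj₂ x≡u′ = contradiction (sym x≡u′) (All.lookup u′∉q (last∈verts q))

      uniquePaths′ : UniquePaths T′
      uniquePaths′ {u} {v} p q P Q with u ≟ x | v ≟ x
      ... | yes refl | yes refl = trans (closedPath⇒edges≡[] p (proj₂ P)) (sym (closedPath⇒edges≡[] q (proj₂ Q)))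
      ... | yes refl | no v≢x =
        let p′ , P′ , p≡ = fromLeaf p P v≢x
            q′ , Q′ , q≡ = fromLeaf q Q v≢x
        in trans p≡ (trans (cong (e ∷_) (unique p′ q′ P′ Q′)) (sym q≡))
      ... | no u≢x | yes refl =
        let p′ , P′ , p≡ , _ = toLeaf p P u≢x
            q′ , Q′ , q≡ , _ = toLeaf q Q u≢x
        in trans p≡ (trans (cong (_++ [ e ]) (unique p′ q′ P′ Q′)) (sym q≡))
      ... | no u≢x | no v≢x = unique p q (avoiding-x p P u≢x v≢x) (avoiding-x q Q u≢x v≢x)

      pathConnected′ : PathConnected T′
      pathConnected′ u∈ v∈ with x∈p∪⁅y⁆⁻ u∈ | x∈p∪⁅y⁆⁻ v∈
      ... | inj₁ u∈T | inj₁ v∈T = Product.map₂ (Product.map₁ (All.map (p⊆p∪q _))) (connected u∈T v∈T)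
      ... | inj₂ refl | inj₁ v∈T =
        let p , pIn , pPath = connected y∈T v∈T
        in cons e j p , (x∈p∪⁅x⁆ e ∷ All.map (p⊆p∪q _) pIn , x≢verts p pIn y∈T ∷ pPath)
      ... | inj₁ u∈T | inj₂ refl =
        let p , pIn , pPath = connected u∈T y∈T
            j′ = Joins-sym j
        in snoc p j′ ,
           subst (All (_∈ₛ ET T′)) (sym (edges-snoc p j′)) (All.++⁺ (All.map (p⊆p∪q _) pIn) (x∈p∪⁅x⁆ e ∷ [])) ,
           subst Unique (sym (verts-snoc p j′))
             (Unique.++⁺ pPath ([] ∷ []) λ { (x∈p , here refl) → All.lookup (x≢verts p pIn u∈T) x∈p refl })
      ... | inj₂ refl | inj₂ refl = nil x , [] , [] ∷ []

  addLeaf-IsPathTree : ∀ T (j : Joins G e x y) (y∈T : y ∈ₛ VT T) → x ∉ₛ VT T → IsPathTree T →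
                       IsPathTree (addLeaf T j y∈T)
  addLeaf-IsPathTree T j y∈T x∉T tree = pathConnected′ , uniquePaths′
    where open AddLeaf T j y∈T x∉T tree

  deleteVertex : Subgraph G → Vertex G → Subgraph G
  deleteVertex T x = record { VT = V′ ; ET = E′ ; closed = closed′ }
    where
    V′ : Subset nV
    V′ = subsetOf (λ v → (v ∈? VT T) ×-dec ¬? (v ≟ x))

    E′ : Subset nE
    E′ = subsetOf (λ f → (f ∈? ET T) ×-dec ¬? (Incident? f x))

    closed′ : ∀ f → f ∈ₛ E′ → src f ∈ₛ V′ × tgt f ∈ₛ V′
    closed′ f f∈ with ∈-subsetOf⁻ _ f∈
    ... | f∈T , f-avoids-x = ∈-subsetOf⁺ _ (proj₁ (closed T f f∈T) , f-avoids-x ∘ inj₁) ,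
                             ∈-subsetOf⁺ _ (proj₂ (closed T f f∈T) , f-avoids-x ∘ inj₂)

  deleteVertex-⊂ : ∀ T → x ∈ₛ VT T → VT (deleteVertex T x) ⊂ VT T
  deleteVertex-⊂ {x = x} _ x∈T = proj₁ ∘ ∈-subsetOf⁻ _ , x , x∈T , λ x∈ → proj₂ (∈-subsetOf⁻ _ x∈) refl

  deleteVertex-IsPathTree : ∀ T → AtMostOneEdgeAt T x → IsPathTree T → IsPathTree (deleteVertex T x)
  deleteVertex-IsPathTree {x = x} T one (connected , unique) = connected′ , unique′
    where
    T′ : Subgraph G
    T′ = deleteVertex T x

    unique′ : UniquePaths T′
    unique′ p q (pIn , pPath) (qIn , qPath) =
      unique p q (All.map (proj₁ ∘ ∈-subsetOf⁻ _) pIn , pPath) (All.map (proj₁ ∘ ∈-subsetOf⁻ _) qIn , qPath)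

    connected′ : PathConnected T′
    connected′ u∈ v∈ with ∈-subsetOf⁻ _ u∈ | ∈-subsetOf⁻ _ v∈
    ... | u∈T , u≢x | v∈T , v≢x =
      let p , pIn , pPath = connected u∈T v∈T
          x∉p : x ∉ verts G p
          x∉p x∈p = Sum.[ u≢x ∘ sym , v≢x ∘ sym ] (AtMostOneEdgeAt⇒endpoint {T = T} p (pIn , pPath) one x∈p)
      in p , All.tabulate (λ f∈p → ∈-subsetOf⁺ _ (All.lookup pIn f∈p , x∉p ∘ Incident⇒∈verts p f∈p)) , pPath

  EdgesAt : Subgraph G → Vertex G → List (Edge G)
  EdgesAt T v = filter (λ f → (f ∈? ET T) ×-dec Incident? f v) (allFin nE)

  private
    EdgesAt-Unique : ∀ T v → Unique (EdgesAt T v)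
    EdgesAt-Unique T v = filter⁺ (λ f → (f ∈? ET T) ×-dec Incident? f v) (allFin⁺ nE)

    ∈EdgesAt⁺ : ∀ T → f ∈ₛ ET T → Incident f v → f ∈ EdgesAt T v
    ∈EdgesAt⁺ {f} {v} T f∈T f-at-v = ∈-filter⁺ (λ f → (f ∈? ET T) ×-dec Incident? f v) (∈-allFin f) (f∈T , f-at-v)

    ∈EdgesAt⁻ : ∀ T → f ∈ EdgesAt T v → f ∈ₛ ET T × Incident f v
    ∈EdgesAt⁻ {v = v} T = proj₂ ∘ ∈-filter⁻ (λ f → (f ∈? ET T) ×-dec Incident? f v) {xs = allFin nE}

  degree≤1⇒AtMostOneEdgeAt : ∀ T → degree G T v ≤ 1 → AtMostOneEdgeAt T v
  degree≤1⇒AtMostOneEdgeAt T d≤1 e∈T f∈T e-at-v f-at-v =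
    length≤1⇒∈-unique d≤1 (∈EdgesAt⁺ T e∈T e-at-v) (∈EdgesAt⁺ T f∈T f-at-v)

  distinctEdges⇒2≤degree : ∀ T → e ∈ₛ ET T → f ∈ₛ ET T → Incident e v → Incident f v → e ≢ f → 2 ≤ degree G T v
  distinctEdges⇒2≤degree T e∈T f∈T e-at-v f-at-v =
    ∈-distinct⇒2≤length (∈EdgesAt⁺ T e∈T e-at-v) (∈EdgesAt⁺ T f∈T f-at-v)

  2≤degree⇒distinctEdges : ∀ T → 2 ≤ degree G T v →
    ∃₂ λ e f → (e ∈ₛ ET T × Incident e v) × (f ∈ₛ ET T × Incident f v) × e ≢ f
  2≤degree⇒distinctEdges {v} T 2≤d with Unique∧2≤length⇒∃-distinct (EdgesAt-Unique T v) 2≤d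
  ... | e , f , e∈ , f∈ , e≢f = e , f , ∈EdgesAt⁻ T e∈ , ∈EdgesAt⁻ T f∈ , e≢f

  AtMostOneEdgeAt⇒degree≡1 : ∀ T → e ∈ₛ ET T → Incident e v → AtMostOneEdgeAt T v → degree G T v ≡ 1
  AtMostOneEdgeAt⇒degree≡1 {v = v} T e∈T e-at-v one =
    Unique∧∈-unique⇒length≡1 (EdgesAt-Unique T v) (∈EdgesAt⁺ T e∈T e-at-v)
      (λ f∈ → let f∈T , f-at-v = ∈EdgesAt⁻ T f∈ in one f∈T e∈T f-at-v e-at-v)

  singleton : Vertex G → Subgraph G
  singleton s = record { VT = ⁅ s ⁆ ; ET = ∅ ; closed = λ _ f∈∅ → contradiction f∈∅ ∉⊥ }

  singleton-IsPathTree : ∀ s → IsPathTree (singleton s)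
  singleton-IsPathTree s = connected , λ p q (pIn , _) (qIn , _) → trans (noEdges p pIn) (sym (noEdges q qIn))
    where
    noEdges : (p : Walk G u v) → WalkIn G (singleton s) p → edges G p ≡ []
    noEdges (nil _)      _          = refl
    noEdges (cons _ _ _) (e∈∅ ∷ _) = contradiction e∈∅ ∉⊥

    connected : PathConnected (singleton s)
    connected u∈ v∈ with x∈⁅y⁆⇒x≡y s u∈ | x∈⁅y⁆⇒x≡y s v∈
    ... | refl | refl = nil s , [] , [] ∷ []

  exitEdge : ∀ {C : Vertex G → Set} (T : Subgraph G) (p : Walk G u w) → All C (verts G p) → u ∈ₛ VT T → w ∉ₛ VT T →
             ∃₂ λ e x → ∃ λ y → Joins G e x y × y ∈ₛ VT T × x ∉ₛ VT T × C x
  exitEdge T (nil _) _ u∈T u∉T = contradiction u∈T u∉T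
  exitEdge T (cons {v = v} e j p) (_ ∷ Cp) u∈T w∉T with v ∈? VT T
  ... | yes v∈T = exitEdge T p Cp v∈T w∉T
  ... | no  v∉T = e , v , _ , Joins-sym j , u∈T , v∉T , All.lookup Cp (head∈verts p)

  SpanningTreeOf : (Vertex G → Set) → Subgraph G → Set
  SpanningTreeOf C T = IsPathTree T × (∀ {v} → v ∈ₛ VT T → C v) × (∀ {v} → C v → v ∈ₛ VT T)

  spanningTree : ∀ {C : Vertex G → Set} → Decidable C →
                 (∀ {u v} → C u → C v → Σ (Walk G u v) (All C ∘ verts G)) →
                 ∀ {s} → C s → ∃ (SpanningTreeOf C)
  spanningTree {C} C? C-connected {s} Cs =
    grow (singleton s) (⊃-wellFounded _) (singleton-IsPathTree s)
         (λ v∈ → subst C (sym (x∈⁅y⁆⇒x≡y s v∈)) Cs) (x∈⁅x⁆ s)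
    where
    grow : (T : Subgraph G) → Acc _⊃_ (VT T) → IsPathTree T → (∀ {v} → v ∈ₛ VT T → C v) → s ∈ₛ VT T →
           ∃ (SpanningTreeOf C)
    grow T (acc larger) tree T⊆C s∈T with any? (λ v → C? v ×-dec ¬? (v ∈? VT T))
    ... | no  C⊆T = T , tree , T⊆C , λ {v} Cv → decidable-stable (v ∈? VT T) (λ v∉T → C⊆T (v , Cv , v∉T))
    ... | yes (v , Cv , v∉T) =
      let p , pC                      = C-connected (T⊆C s∈T) Cv
          _ , x , _ , j , y∈T , x∉T , Cx = exitEdge T p pC s∈T v∉T
      in grow (addLeaf T j y∈T) (larger (addLeaf-⊃ T j y∈T x∉T)) (addLeaf-IsPathTree T j y∈T x∉T tree)
              (λ v∈ → Sum.[ T⊆C , (λ { refl → Cx }) ] (x∈p∪⁅y⁆⁻ v∈)) (p⊆p∪q _ s∈T)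

  Pruned : (Vertex G → Set) → Subgraph G → Set
  Pruned K T = ∀ {v} → v ∈ₛ VT T → ¬ K v → 2 ≤ degree G T v

  PrunedSubtreeOf : (Vertex G → Set) → Subgraph G → Subgraph G → Set
  PrunedSubtreeOf K T T′ = IsPathTree T′ × VT T′ ⊆ₛ VT T × (∀ {v} → v ∈ₛ VT T → K v → v ∈ₛ VT T′) × Pruned K T′

  prune : ∀ {K : Vertex G → Set} → Decidable K → ∀ T → IsPathTree T → ∃ (PrunedSubtreeOf K T)
  prune {K} K? T tree = go T (⊂-wellFounded _) tree
    where
    go : (T : Subgraph G) → Acc _⊂_ (VT T) → IsPathTree T → ∃ (PrunedSubtreeOf K T)
    go T (acc smaller) tree with any? (λ v → (v ∈? VT T) ×-dec ¬? (K? v) ×-dec (degree G T v ≤? 1))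
    ... | no  none = T , tree , id , (λ v∈T _ → v∈T) , λ {v} v∈T ¬Kv → ≰⇒> (λ d≤1 → none (v , v∈T , ¬Kv , d≤1))
    ... | yes (x , x∈T , ¬Kx , d≤1) =
      let T′ , tree′ , T′⊆ , keeps , pruned = go (deleteVertex T x) (smaller (deleteVertex-⊂ T x∈T))
                                                  (deleteVertex-IsPathTree T (degree≤1⇒AtMostOneEdgeAt T d≤1) tree)
      in T′ , tree′ , proj₁ ∘ ∈-subsetOf⁻ _ ∘ T′⊆ ,
         (λ v∈T Kv → keeps (∈-subsetOf⁺ _ (v∈T , λ { refl → ¬Kx Kv })) Kv) , pruned

  module AttachLeaves (S : Subgraph G) (anchorEdge : Vertex G → Edge G) (anchor : Vertex G → Vertex G) where

    Anchored : Vertex G → Set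
    Anchored r = Joins G (anchorEdge r) r (anchor r) × anchor r ∈ₛ VT S

    attach : (L : List (Vertex G)) → All Anchored L → Subgraph G
    VT-attach⁺ˡ : ∀ L (as : All Anchored L) → VT S ⊆ₛ VT (attach L as)

    attach []      []               = S
    attach (r ∷ L) ((j , a∈S) ∷ as) = addLeaf (attach L as) j (VT-attach⁺ˡ L as a∈S)

    VT-attach⁺ˡ []      []       = id
    VT-attach⁺ˡ (_ ∷ L) (_ ∷ as) = p⊆p∪q _ ∘ VT-attach⁺ˡ L as

    VT-attach⁺ʳ : ∀ {L} (as : All Anchored L) {r} → r ∈ L → r ∈ₛ VT (attach L as)
    VT-attach⁺ʳ (_ ∷ _)  (here refl) = x∈p∪⁅x⁆ _
    VT-attach⁺ʳ (_ ∷ as) (there r∈L) = p⊆p∪q _ (VT-attach⁺ʳ as r∈L)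

    VT-attach⁻ : ∀ {L} (as : All Anchored L) → v ∈ₛ VT (attach L as) → v ∈ₛ VT S ⊎ v ∈ L
    VT-attach⁻ []       v∈S = inj₁ v∈S
    VT-attach⁻ (_ ∷ as) v∈  with x∈p∪⁅y⁆⁻ v∈
    ... | inj₁ v∈′ = Sum.map₂ there (VT-attach⁻ as v∈′)
    ... | inj₂ refl = inj₂ (here refl)

    ET-attach⁺ˡ : ∀ {L} (as : All Anchored L) → ET S ⊆ₛ ET (attach L as)
    ET-attach⁺ˡ []       = id
    ET-attach⁺ˡ (_ ∷ as) = p⊆p∪q _ ∘ ET-attach⁺ˡ as

    ET-attach⁺ʳ : ∀ {L} (as : All Anchored L) {r} → r ∈ L → anchorEdge r ∈ₛ ET (attach L as)
    ET-attach⁺ʳ (_ ∷ _)  (here refl) = x∈p∪⁅x⁆ _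
    ET-attach⁺ʳ (_ ∷ as) (there r∈L) = p⊆p∪q _ (ET-attach⁺ʳ as r∈L)

    ET-attach⁻ : ∀ {L} (as : All Anchored L) → f ∈ₛ ET (attach L as) → f ∈ₛ ET S ⊎ ∃ λ r → r ∈ L × anchorEdge r ≡ f
    ET-attach⁻ []       f∈S = inj₁ f∈S
    ET-attach⁻ (_ ∷ as) f∈  with x∈p∪⁅y⁆⁻ f∈
    ... | inj₁ f∈′ = Sum.map₂ (Product.map₂ (Product.map₁ there)) (ET-attach⁻ as f∈′)
    ... | inj₂ refl = inj₂ (_ , here refl , refl)

    attach-IsPathTree : ∀ {L} (as : All Anchored L) → Unique L → All (_∉ₛ VT S) L → IsPathTree S →
                        IsPathTree (attach L as)
    attach-IsPathTree []                []             []           tree = tree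
    attach-IsPathTree {r ∷ L} ((j , a∈S) ∷ as) (r∉L ∷ L-Unique) (r∉S ∷ L∉S) tree =
      addLeaf-IsPathTree (attach L as) j (VT-attach⁺ˡ L as a∈S) r∉attach (attach-IsPathTree as L-Unique L∉S tree)
      where
      r∉attach : r ∉ₛ VT (attach L as)
      r∉attach r∈ = Sum.[ r∉S , (λ r∈L → All.lookup r∉L r∈L refl) ] (VT-attach⁻ as r∈)

  module _ {k} (R : Subset nV) (Ts : Fin k → Subgraph G) (Part : Fin k → Vertex G → Set)
           (Part-disjoint : ∀ {i j v} → Part i v → Part j v → i ≡ j)
           (Part⇒∉R : ∀ {i v} → Part i v → v ∉ₛ R)
           (R⊆Ts : ∀ i → R ⊆ₛ VT (Ts i))
           (vertices-in-Part : ∀ i {v} → v ∈ₛ VT (Ts i) → v ∉ₛ R → Part i v)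
           (edges-in-Part : ∀ i {f} → f ∈ₛ ET (Ts i) → Part i (src f) ⊎ Part i (tgt f))
           (R-oneEdge : ∀ i {r} → r ∈ₛ R → AtMostOneEdgeAt (Ts i) r)
           where

    independentPaths : ∀ u v → u ∈ₛ R → v ∈ₛ R → u ≢ v → ∀ i j → i ≢ j →
                       ∀ (p q : Walk G u v) → PathIn G (Ts i) p → PathIn G (Ts j) q →
                       EdgeDisjoint G p q × InternallyDisjoint G p q
    independentPaths u v u∈R _ _ i j i≢j p q P@(pIn , _) (qIn , _) = edgeDisjoint , internallyDisjoint
      where
      notInTⱼ : ∀ {x} → Part i x → x ∉ₛ VT (Ts j)
      notInTⱼ Pᵢx x∈Tⱼ = i≢j (Part-disjoint Pᵢx (vertices-in-Part j x∈Tⱼ (Part⇒∉R Pᵢx)))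

      edgeDisjoint : EdgeDisjoint G p q
      edgeDisjoint f f∈p f∈q with closed (Ts j) f (All.lookup qIn f∈q) | edges-in-Part i (All.lookup pIn f∈p)
      ... | src∈Tⱼ , _ | inj₁ Pᵢsrc = notInTⱼ Pᵢsrc src∈Tⱼ
      ... | _ , tgt∈Tⱼ | inj₂ Pᵢtgt = notInTⱼ Pᵢtgt tgt∈Tⱼ

      internallyDisjoint : InternallyDisjoint G p q
      internallyDisjoint x x∈p x∈q with x ∈? R
      ... | yes x∈R = AtMostOneEdgeAt⇒endpoint {T = Ts i} p P (R-oneEdge i x∈R) x∈p
      ... | no  x∉R = contradiction x∈Tⱼ (notInTⱼ (vertices-in-Part i x∈Tᵢ x∉R))
        where
        x∈Tᵢ : x ∈ₛ VT (Ts i)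
        x∈Tᵢ = All.lookup (WalkIn⇒verts∈VT (Ts i) p pIn (R⊆Ts i u∈R)) x∈p
        x∈Tⱼ : x ∈ₛ VT (Ts j)
        x∈Tⱼ = All.lookup (WalkIn⇒verts∈VT (Ts j) q qIn (R⊆Ts j u∈R)) x∈q

module CutComponents (G : Graph) (R : Subset (Graph.nV G)) {k : ℕ} (c : (v : Vertex G) → v ∉ₛ R → Fin k)
  (c-components : ∀ u v (u∉R : u ∉ₛ R) (v∉R : v ∉ₛ R) →
     (c u u∉R ≡ c v v∉R → ConnectedAvoiding G R u v) × (ConnectedAvoiding G R u v → c u u∉R ≡ c v v∉R))
  where
  open Graph G
  open Subgraph
  open GraphTheory G

  InComponent : Fin k → Vertex G → Set
  InComponent i v = Σ (v ∉ₛ R) λ v∉R → c v v∉R ≡ i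

  c-irrelevant : ∀ v (p q : v ∉ₛ R) → c v p ≡ c v q
  c-irrelevant v p q = proj₂ (c-components v v p q) (nil v , p ∷ [])

  InComponent-functional : ∀ {i j v} → InComponent i v → InComponent j v → i ≡ j
  InComponent-functional (p , cp≡i) (q , cq≡j) = trans (sym cp≡i) (trans (c-irrelevant _ p q) cq≡j)

  InComponent? : ∀ i → Decidable (InComponent i)
  InComponent? i v with v ∈? R
  ... | yes v∈R = no λ (v∉R , _) → v∉R v∈R
  ... | no  v∉R with c v v∉R ≟ i
  ...   | yes cv≡i = yes (v∉R , cv≡i)
  ...   | no  cv≢i = no λ (v∉R′ , cv≡i) → cv≢i (trans (c-irrelevant v v∉R v∉R′) cv≡i)

  Joins⇒sameComponent : ∀ {e u v} → Joins G e u v → (u∉R : u ∉ₛ R) (v∉R : v ∉ₛ R) → c u u∉R ≡ c v v∉R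
  Joins⇒sameComponent j u∉R v∉R = proj₂ (c-components _ _ u∉R v∉R) (cons _ j (nil _) , u∉R ∷ v∉R ∷ [])

  Neighbour : Fin k → Vertex G → Edge G → Set
  Neighbour i r e = ∃ λ a → Joins G e r a × InComponent i a

  Neighbour? : ∀ i r → Decidable (Neighbour i r)
  Neighbour? i r e =
    map′ fromCases toCases ((src e ≟ r ×-dec InComponent? i (tgt e)) ⊎-dec (tgt e ≟ r ×-dec InComponent? i (src e)))
    where
    fromCases : (src e ≡ r × InComponent i (tgt e)) ⊎ (tgt e ≡ r × InComponent i (src e)) → Neighbour i r e
    fromCases (inj₁ (s≡r , Ct)) = tgt e , inj₁ (s≡r , refl) , Ct
    fromCases (inj₂ (t≡r , Cs)) = src e , inj₂ (refl , t≡r) , Cs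
    toCases : Neighbour i r e → (src e ≡ r × InComponent i (tgt e)) ⊎ (tgt e ≡ r × InComponent i (src e))
    toCases (a , inj₁ (s≡r , t≡a) , Ca) = inj₁ (s≡r , subst (InComponent i) (sym t≡a) Ca)
    toCases (a , inj₂ (s≡a , t≡r) , Ca) = inj₂ (t≡r , subst (InComponent i) (sym s≡a) Ca)

  walk-stays-in-component : ∀ {i u w} → InComponent i u → (p : Walk G u w) →
    All (λ v → v ∉ₛ R ⊎ ¬ ∃ (Neighbour i v)) (verts G p) → All (InComponent i) (verts G p)
  walk-stays-in-component Cu (nil _)      _        = Cu ∷ []
  walk-stays-in-component Cu (cons e j p) (_ ∷ ok) with All.lookup ok (head∈verts p)
  ... | inj₁ v∉R =
    Cu ∷ walk-stays-in-component (v∉R , trans (sym (Joins⇒sameComponent j (proj₁ Cu) v∉R)) (proj₂ Cu)) p ok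
  ... | inj₂ noNeighbour = contradiction (e , _ , Joins-sym j , Cu) noNeighbour

  component-connected : ∀ {i u v} → InComponent i u → InComponent i v →
                        Σ (Walk G u v) (All (InComponent i) ∘ verts G)
  component-connected {u = u} {v} Cu@(u∉R , cu≡i) (v∉R , cv≡i) =
    let p , p∉R = proj₁ (c-components u v u∉R v∉R) (trans cu≡i (sym cv≡i))
    in p , walk-stays-in-component Cu p (All.map inj₁ p∉R)

  outsideComponent : IsVertexCut G R → ∀ i → ∃ λ v → Σ (v ∉ₛ R) λ v∉R → c v v∉R ≢ i
  outsideComponent (u , v , u∉R , v∉R , disconnected) i with c u u∉R ≟ i
  ... | no  cu≢i = u , u∉R , cu≢i
  ... | yes cu≡i = v , v∉R , λ cv≡i → disconnected (proj₁ (c-components u v u∉R v∉R) (trans cu≡i (sym cv≡i)))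

  neighbourInEveryComponent : IsVertexCut G R → (∀ S → S ⊂ R → ¬ IsVertexCut G S) → (∀ i → ∃ (InComponent i)) →
                              ∀ i {r} → r ∈ₛ R → ∃ (Neighbour i r)
  neighbourInEveryComponent cut minimal nonempty i {r} r∈R =
    decidable-stable (any? (Neighbour? i r)) λ noNeighbour →
      minimal (R - r) (x∈p⇒p-x⊂p r∈R) (R-r-separates noNeighbour)
    where
    ∉R⇒∉R-r : ∀ {v} → v ∉ₛ R → v ∉ₛ R - r
    ∉R⇒∉R-r v∉R = v∉R ∘ p─q⊆p R _

    R-r-separates : ¬ ∃ (Neighbour i r) → IsVertexCut G (R - r)
    R-r-separates noNeighbour =
      let u , Cu            = nonempty i
          v , v∉R , cv≢i   = outsideComponent cut i
      in u , v , ∉R⇒∉R-r (proj₁ Cu) , ∉R⇒∉R-r v∉R ,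
         λ (p , p∉R-r) → let v∉R′ , cv≡i = All.lookup (walk-stays-in-component Cu p (All.map onlyR p∉R-r)) (last∈verts p)
                         in cv≢i (trans (c-irrelevant v v∉R v∉R′) cv≡i)
      where
      onlyR : ∀ {x} → x ∉ₛ R - r → x ∉ₛ R ⊎ ¬ ∃ (Neighbour i x)
      onlyR {x} x∉R-r with x ≟ r
      ... | yes refl = inj₂ noNeighbour
      ... | no  x≢r  = inj₁ λ x∈R → x∉R-r (x∈p∧x≢y⇒x∈p-y x∈R x≢r)

  module ComponentTree (i : Fin k) (neighbour : ∀ {r} → r ∈ₛ R → ∃ (Neighbour i r))
      {s} (s∈Cᵢ : InComponent i s) {r₁ r₂} (r₁∈R : r₁ ∈ₛ R) (r₂∈R : r₂ ∈ₛ R) (r₁≢r₂ : r₁ ≢ r₂) where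

    anchoring : Vertex G → Edge G × Vertex G
    anchoring r with any? (Neighbour? i r)
    ... | yes (e , a , _) = e , a
    -- Junk value: only vertices of R are ever anchored.
    ... | no  _           = proj₁ (neighbour r₁∈R) , r

    anchorEdge : Vertex G → Edge G
    anchorEdge = proj₁ ∘ anchoring

    anchor : Vertex G → Vertex G
    anchor = proj₂ ∘ anchoring

    anchoring-spec : ∀ {r} → r ∈ₛ R → Joins G (anchorEdge r) r (anchor r) × InComponent i (anchor r)
    anchoring-spec {r} r∈R with any? (Neighbour? i r)
    ... | yes (_ , _ , j , Ca) = j , Ca
    ... | no  noNeighbour      = contradiction (neighbour r∈R) noNeighbour

    anchorEdge-joins : ∀ {r} → r ∈ₛ R → Joins G (anchorEdge r) r (anchor r)
    anchorEdge-joins = proj₁ ∘ anchoring-spec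

    anchor∈Cᵢ : ∀ {r} → r ∈ₛ R → InComponent i (anchor r)
    anchor∈Cᵢ = proj₂ ∘ anchoring-spec

    IsAnchor : Vertex G → Set
    IsAnchor v = ∃ λ r → r ∈ₛ R × anchor r ≡ v

    IsAnchor? : Decidable IsAnchor
    IsAnchor? v = any? λ r → (r ∈? R) ×-dec (anchor r ≟ v)

    private opaque
      spanning : ∃ (SpanningTreeOf (InComponent i))
      spanning = spanningTree (InComponent? i) component-connected s∈Cᵢ

      pruned : ∃ (PrunedSubtreeOf IsAnchor (proj₁ spanning))
      pruned = prune IsAnchor? (proj₁ spanning) (proj₁ (proj₂ spanning))

    S : Subgraph G
    S = proj₁ pruned

    S-tree : IsPathTree S
    S-tree = proj₁ (proj₂ pruned)

    S⊆Cᵢ : ∀ {v} → v ∈ₛ VT S → InComponent i v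
    S⊆Cᵢ = proj₁ (proj₂ (proj₂ spanning)) ∘ proj₁ (proj₂ (proj₂ pruned))

    anchor∈S : ∀ {r} → r ∈ₛ R → anchor r ∈ₛ VT S
    anchor∈S {r} r∈R = proj₁ (proj₂ (proj₂ (proj₂ pruned)))
      (proj₂ (proj₂ (proj₂ spanning)) (anchor∈Cᵢ r∈R)) (r , r∈R , refl)

    S-pruned : Pruned IsAnchor S
    S-pruned = proj₂ (proj₂ (proj₂ (proj₂ pruned)))

    S-avoids-R : ∀ {v} → v ∈ₛ VT S → v ∉ₛ R
    S-avoids-R = proj₁ ∘ S⊆Cᵢ

    Rs : List (Vertex G)
    Rs = filter (_∈? R) (allFin nV)

    ∈Rs⁺ : ∀ {r} → r ∈ₛ R → r ∈ Rs
    ∈Rs⁺ {r} = ∈-filter⁺ (_∈? R) (∈-allFin r)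

    ∈Rs⁻ : ∀ {r} → r ∈ Rs → r ∈ₛ R
    ∈Rs⁻ = proj₂ ∘ ∈-filter⁻ (_∈? R) {xs = allFin nV}

    open AttachLeaves S anchorEdge anchor

    Rs-anchored : All Anchored Rs
    Rs-anchored = All.tabulate λ r∈Rs → anchorEdge-joins (∈Rs⁻ r∈Rs) , anchor∈S (∈Rs⁻ r∈Rs)

    T : Subgraph G
    T = attach Rs Rs-anchored

    T-tree : IsPathTree T
    T-tree = attach-IsPathTree Rs-anchored (filter⁺ (_∈? R) (allFin⁺ nV))
               (All.tabulate λ r∈Rs r∈S → S-avoids-R r∈S (∈Rs⁻ r∈Rs)) S-tree

    R⊆T : ∀ {r} → r ∈ₛ R → r ∈ₛ VT T
    R⊆T = VT-attach⁺ʳ Rs-anchored ∘ ∈Rs⁺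

    T-outside-R : ∀ {v} → v ∈ₛ VT T → v ∉ₛ R → InComponent i v
    T-outside-R v∈T v∉R = Sum.[ S⊆Cᵢ , (λ v∈Rs → contradiction (∈Rs⁻ v∈Rs) v∉R) ] (VT-attach⁻ Rs-anchored v∈T)

    T-edges : ∀ {f} → f ∈ₛ ET T → InComponent i (src f) ⊎ InComponent i (tgt f)
    T-edges f∈T with ET-attach⁻ Rs-anchored f∈T
    ... | inj₁ f∈S = inj₁ (S⊆Cᵢ (proj₁ (closed S _ f∈S)))
    ... | inj₂ (r , r∈Rs , refl) with anchoring-spec (∈Rs⁻ r∈Rs)
    ...   | inj₁ (_ , t≡a) , Ca = inj₂ (subst (InComponent i) (sym t≡a) Ca)
    ...   | inj₂ (s≡a , _) , Ca = inj₁ (subst (InComponent i) (sym s≡a) Ca)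

    anchorEdge∈T : ∀ {r} → r ∈ₛ R → anchorEdge r ∈ₛ ET T
    anchorEdge∈T = ET-attach⁺ʳ Rs-anchored ∘ ∈Rs⁺

    edgeAt-R : ∀ {r f} → r ∈ₛ R → f ∈ₛ ET T → Incident f r → f ≡ anchorEdge r
    edgeAt-R r∈R f∈T f-at-r with ET-attach⁻ Rs-anchored f∈T
    ... | inj₁ f∈S = contradiction r∈R (S-avoids-R (Incident⇒∈VT S f∈S f-at-r))
    ... | inj₂ (r′ , r′∈Rs , refl) with Incident⇒endpoint (anchorEdge-joins (∈Rs⁻ r′∈Rs)) f-at-r
    ...   | inj₁ refl = refl
    ...   | inj₂ r≡a  = contradiction r∈R (proj₁ (subst (InComponent i) (sym r≡a) (anchor∈Cᵢ (∈Rs⁻ r′∈Rs))))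

    oneEdgeAt-R : ∀ {r} → r ∈ₛ R → AtMostOneEdgeAt T r
    oneEdgeAt-R r∈R e∈T f∈T e-at-r f-at-r = trans (edgeAt-R r∈R e∈T e-at-r) (sym (edgeAt-R r∈R f∈T f-at-r))

    degree-R : ∀ {r} → r ∈ₛ R → degree G T r ≡ 1
    degree-R r∈R =
      AtMostOneEdgeAt⇒degree≡1 T (anchorEdge∈T r∈R) (Joins⇒Incidentˡ (anchorEdge-joins r∈R)) (oneEdgeAt-R r∈R)

    private
      anchorEdge∉S : ∀ {r} → r ∈ₛ R → anchorEdge r ∉ₛ ET S
      anchorEdge∉S r∈R e∈S = S-avoids-R (Incident⇒∈VT S e∈S (Joins⇒Incidentˡ (anchorEdge-joins r∈R))) r∈R

      S-vertex≢anchor⇒2≤degree : ∀ {r z} → r ∈ₛ R → z ∈ₛ VT S → anchor r ≢ z → 2 ≤ degree G T (anchor r)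
      S-vertex≢anchor⇒2≤degree r∈R z∈S a≢z with proj₁ S-tree (anchor∈S r∈R) z∈S
      ... | nil _ , _ = contradiction refl a≢z
      ... | cons f j _ , (f∈S ∷ _ , _) =
        distinctEdges⇒2≤degree T (ET-attach⁺ˡ Rs-anchored f∈S) (anchorEdge∈T r∈R)
          (Joins⇒Incidentˡ j) (Joins⇒Incidentʳ (anchorEdge-joins r∈R)) λ { refl → anchorEdge∉S r∈R f∈S }

      shared-anchor⇒2≤degree : ∀ {r r′} → r ∈ₛ R → r′ ∈ₛ R → r ≢ r′ → anchor r ≡ anchor r′ →
                               2 ≤ degree G T (anchor r)
      shared-anchor⇒2≤degree {r} {r′} r∈R r′∈R r≢r′ a≡a′ =
        distinctEdges⇒2≤degree T (anchorEdge∈T r∈R) (anchorEdge∈T r′∈R) (Joins⇒Incidentʳ j) (Joins⇒Incidentʳ j′)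
          λ e≡e′ → r≢r′ (Joins-functional (Joins-sym j) (Joins-sym (subst (λ e → Joins G e r′ (anchor r)) (sym e≡e′) j′)))
        where
        j : Joins G (anchorEdge r) r (anchor r)
        j = anchorEdge-joins r∈R

        j′ : Joins G (anchorEdge r′) r′ (anchor r)
        j′ = subst (Joins G (anchorEdge r′) r′) (sym a≡a′) (anchorEdge-joins r′∈R)

    2≤degree-anchor : ∀ {r} → r ∈ₛ R → 2 ≤ degree G T (anchor r)
    2≤degree-anchor {r} r∈R with anchor r ≟ anchor r₁ | anchor r ≟ anchor r₂
    ... | no a≢a₁  | _         = S-vertex≢anchor⇒2≤degree r∈R (anchor∈S r₁∈R) a≢a₁
    ... | yes _    | no a≢a₂   = S-vertex≢anchor⇒2≤degree r∈R (anchor∈S r₂∈R) a≢a₂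
    ... | yes a≡a₁ | yes a≡a₂ =
      subst (λ a → 2 ≤ degree G T a) (sym a≡a₁) (shared-anchor⇒2≤degree r₁∈R r₂∈R r₁≢r₂ (trans (sym a≡a₁) a≡a₂))

    2≤degree-S : ∀ {v} → v ∈ₛ VT S → 2 ≤ degree G T v
    2≤degree-S {v} v∈S with IsAnchor? v
    ... | yes (r , r∈R , refl) = 2≤degree-anchor r∈R
    ... | no  ¬anchor          =
      let e , f , (e∈S , e-at-v) , (f∈S , f-at-v) , e≢f = 2≤degree⇒distinctEdges S (S-pruned v∈S ¬anchor)
      in distinctEdges⇒2≤degree T (ET-attach⁺ˡ Rs-anchored e∈S) (ET-attach⁺ˡ Rs-anchored f∈S) e-at-v f-at-v e≢f

    leaves⊆R : ∀ v → IsLeaf G T v → v ∈ₛ R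
    leaves⊆R v (v∈T , degree≡1) with VT-attach⁻ Rs-anchored v∈T
    ... | inj₁ v∈S  = contradiction (subst (2 ≤_) degree≡1 (2≤degree-S v∈S)) (n≮n 1)
    ... | inj₂ v∈Rs = ∈Rs⁻ v∈Rs

    T-pendant : IsPendantSteinerTree G R T
    T-pendant = (IsPathTree⇒IsTree {T = T} T-tree , R⊆T , leaves⊆R) , λ _ r∈R → R⊆T r∈R , degree-R r∈R

proposition3p17 : (G : Graph) → Connected G →
    (R : Subset (Graph.nV G)) → ∣ R ∣ ≥ 2 → IsMinimalVertexCut G R →
    (k : ℕ) → HasComponents G R k →
    Σ (Fin k → Subgraph G) (IsPendantCIST G R k)
proposition3p17 G _ R 2≤∣R∣ (cut , minimal) k (c , nonempty , c-components)
  with 2≤∣p∣⇒∃-distinct R 2≤∣R∣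
... | r₁ , r₂ , r₁∈R , r₂∈R , r₁≢r₂ =
  Tree.T , ((λ i → proj₁ (Tree.T-pendant i)) , independentPaths R Tree.T InComponent InComponent-functional proj₁
                                                   Tree.R⊆T Tree.T-outside-R Tree.T-edges Tree.oneEdgeAt-R) ,
  Tree.T-pendant
  where
  open CutComponents G R c c-components
  open GraphTheory G using (independentPaths)
  module Tree i = ComponentTree i (neighbourInEveryComponent cut minimal nonempty i) (proj₂ (nonempty i))
                                r₁∈R r₂∈R r₁≢r₂
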